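{- Let $n,k$ be natural numbers with $k<n-k$, let $X=\{1,\ldots,n\}$, and let $L_{k,n}=(V,E)$ be the bipartite graph with $V=[X]^{k}\cup[X]^{n-k}$ and $E=\{AB : A\in[X]^{k},\ B\in[X]^{n-k},\ A\subseteq B\}$. For $A,B\in V$ let $\|AB\|$ denote the graph distance in $L_{k,n}$. If $A,B\in V$ and $|A\cap B|=i$, then: (1) if $|A|\neq|B|$, then $\|AB\|\leq 2\left\lceil \frac{k-i}{n-2k}\right\rceil+1$; (2) if $|A|=|B|$, then $\|AB\|\leq 2\left\lceil \frac{|A|-i}{n-2k}\right\rceil$.
   Context: $[X]^m$ denotes the set of all $m$-element subsets of $X$. The graph distance is the length of a shortest path, with distance $0$ iff the vertices are equal. -}

module Defs where

open import Data.Nat using (ℕ; zero; suc; _+_; _*_; _∸_; _≤_)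
open import Data.Nat.DivMod using (_/_)
open import Data.Fin.Subset using (Subset; _⊆_; ∣_∣)
open import Data.Product using (_×_; Σ-syntax)
open import Data.Sum using (_⊎_)
open import Relation.Binary.PropositionalEquality using (_≡_)

-- ceiling division ⌈ a / b ⌉ for b > 0 (value at b = 0 is irrelevant: set to 0)
⌈_/_⌉ : ℕ → ℕ → ℕ
⌈ a / zero ⌉ = 0
⌈ a / suc m ⌉ = (a + m) / suc m

IsVertex : (n k : ℕ) → Subset n → Set
IsVertex n k A = ∣ A ∣ ≡ k ⊎ ∣ A ∣ ≡ n ∸ k

Edge : (n k : ℕ) → Subset n → Subset n → Set
Edge n k A B =
  (∣ A ∣ ≡ k × ∣ B ∣ ≡ n ∸ k × A ⊆ B) ⊎ (∣ B ∣ ≡ k × ∣ A ∣ ≡ n ∸ k × B ⊆ A)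

data Walk (n k : ℕ) : Subset n → Subset n → ℕ → Set where
  here : ∀ {A} → Walk n k A A 0
  step : ∀ {A B C l} → Edge n k A B → Walk n k B C l → Walk n k A C (suc l)

-- ‖AB‖ ≤ d : the graph distance (length of a shortest path) is at most d,
-- i.e. there is a walk from A to B of length at most d
Dist≤ : (n k : ℕ) → Subset n → Subset n → ℕ → Set
Dist≤ n k A B d = Σ[ l ∈ ℕ ] (Walk n k A B l × l ≤ d)

-- Let m = n - 2k > 0 and call k - |A ∩ A′| the deficit of two k-sets A, A′.
-- Take B of size n - k with A ⊆ B ⊆ A ∪ A′ (or B ⊇ A ∪ A′ when |A ∪ A′| < n - k);
-- then |B ∩ A′| = m + |A ∩ A′|, and a k-set C with B ∩ A′ ⊆ C ⊆ B is two steps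
-- from A with deficit smaller by m (or C = A′). Iterating gives distance 2⌈(k - i)/m⌉.
-- Two (n - k)-sets step down to k-subsets that still contain their intersection,
-- whose deficit is at most ((n - k) - i) - m; a k-set and an (n - k)-set step
-- from the latter to such a k-subset.

module Submission where

open import Defs
open import Data.Nat using (ℕ; zero; suc; _+_; _*_; _∸_; _<_; _≤_; z≤n; s≤s; _≤?_)
open import Data.Nat.Properties
open import Data.Nat.DivMod using (_/_; _%_; m≡m%n+[m/n]*n; m%n<n)
open import Data.Fin.Subset using (Subset; _∩_; _∪_; ∣_∣; _⊆_; inside; outside; ⊤; ⊥)
open import Data.Fin.Subset.Properties
open import Data.Vec using (_∷_; []; here)
open import Data.Product using (_×_; _,_; Σ-syntax; proj₁; proj₂)
open import Data.Sum using (inj₁; inj₂; [_,_])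
open import Data.Empty using (⊥-elim)
open import Relation.Nullary using (yes; no)
open import Relation.Binary.PropositionalEquality
  using (_≡_; _≢_; refl; sym; trans; cong; cong₂; subst; module ≡-Reasoning)

Edge-sym : ∀ {n k A B} → Edge n k A B → Edge n k B A
Edge-sym (inj₁ e) = inj₂ e
Edge-sym (inj₂ e) = inj₁ e

_++ʷ_ : ∀ {n k A B C l l′} → Walk n k A B l → Walk n k B C l′ → Walk n k A C (l + l′)
here     ++ʷ w′ = w′
step e w ++ʷ w′ = step e (w ++ʷ w′)

reverseʷ : ∀ {n k A B l} → Walk n k A B l → Walk n k B A l
reverseʷ here = here
reverseʷ {n} {k} {A} (step {l = l} e w) =
  subst (Walk n k _ A) (+-comm l 1) (reverseʷ w ++ʷ step (Edge-sym e) here)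

Dist≤-refl : ∀ {n k A d} → Dist≤ n k A A d
Dist≤-refl = 0 , here , z≤n

Dist≤-≡ : ∀ {n k A B d} → A ≡ B → Dist≤ n k A B d
Dist≤-≡ refl = Dist≤-refl

Dist≤-sym : ∀ {n k A B d} → Dist≤ n k A B d → Dist≤ n k B A d
Dist≤-sym (l , w , l≤d) = l , reverseʷ w , l≤d

Dist≤-trans : ∀ {n k A B C d d′} →
  Dist≤ n k A B d → Dist≤ n k B C d′ → Dist≤ n k A C (d + d′)
Dist≤-trans (l , w , l≤d) (l′ , w′ , l′≤d′) = l + l′ , w ++ʷ w′ , +-mono-≤ l≤d l′≤d′

Dist≤-weaken : ∀ {n k A B d d′} → d ≤ d′ → Dist≤ n k A B d → Dist≤ n k A B d′
Dist≤-weaken d≤d′ (l , w , l≤d) = l , w , ≤-trans l≤d d≤d′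

Edge⇒Dist≤1 : ∀ {n k A B} → Edge n k A B → Dist≤ n k A B 1
Edge⇒Dist≤1 e = 1 , step e here , ≤-refl

commonNeighbour⇒Dist≤2 : ∀ {n k A B C} → Edge n k A B → Edge n k C B → Dist≤ n k A C 2
commonNeighbour⇒Dist≤2 e e′ = Dist≤-trans (Edge⇒Dist≤1 e) (Edge⇒Dist≤1 (Edge-sym e′))

∃-⊆-between : ∀ {n} {S U : Subset n} t → S ⊆ U → ∣ S ∣ ≤ t → t ≤ ∣ U ∣ →
  Σ[ T ∈ Subset n ] (S ⊆ T × T ⊆ U × ∣ T ∣ ≡ t)
∃-⊆-between {S = []} {[]} t _ _ t≤0 = [] , (λ ()) , (λ ()) , sym (n≤0⇒n≡0 t≤0)
∃-⊆-between {S = inside ∷ S} {outside ∷ U} t S⊆U _ _ with S⊆U here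
... | ()
∃-⊆-between {S = inside ∷ S} {inside ∷ U} (suc t) S⊆U (s≤s s≤t) (s≤s t≤u)
  with ∃-⊆-between t (drop-∷-⊆ S⊆U) s≤t t≤u
... | T , S⊆T , T⊆U , ∣T∣≡t = inside ∷ T , in⊆in S⊆T , in⊆in T⊆U , cong suc ∣T∣≡t
∃-⊆-between {S = outside ∷ S} {outside ∷ U} t S⊆U s≤t t≤u
  with ∃-⊆-between t (drop-∷-⊆ S⊆U) s≤t t≤u
... | T , S⊆T , T⊆U , ∣T∣≡t = outside ∷ T , s⊆s S⊆T , s⊆s T⊆U , ∣T∣≡t
∃-⊆-between {S = outside ∷ S} {inside ∷ U} t S⊆U s≤t t≤1+u with t ≤? ∣ U ∣
... | yes t≤u with ∃-⊆-between t (drop-∷-⊆ S⊆U) s≤t t≤u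
...   | T , S⊆T , T⊆U , ∣T∣≡t = outside ∷ T , s⊆s S⊆T , out⊆ T⊆U , ∣T∣≡t
∃-⊆-between {S = outside ∷ S} {inside ∷ U} t S⊆U s≤t t≤1+u | no t≰u =
  inside ∷ U , out⊆ (drop-∷-⊆ S⊆U) , ⊆-refl , ≤-antisym (≰⇒> t≰u) t≤1+u

p⊆q∧∣q∣≤∣p∣⇒q⊆p : ∀ {n} {p q : Subset n} → p ⊆ q → ∣ q ∣ ≤ ∣ p ∣ → q ⊆ p
p⊆q∧∣q∣≤∣p∣⇒q⊆p {p = []} {[]} _ _ ()
p⊆q∧∣q∣≤∣p∣⇒q⊆p {p = inside ∷ p} {outside ∷ q} p⊆q _ with p⊆q here
... | ()
p⊆q∧∣q∣≤∣p∣⇒q⊆p {p = inside ∷ p} {inside ∷ q} p⊆q (s≤s ∣q∣≤∣p∣) =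
  in⊆in (p⊆q∧∣q∣≤∣p∣⇒q⊆p (drop-∷-⊆ p⊆q) ∣q∣≤∣p∣)
p⊆q∧∣q∣≤∣p∣⇒q⊆p {p = outside ∷ p} {outside ∷ q} p⊆q ∣q∣≤∣p∣ =
  s⊆s (p⊆q∧∣q∣≤∣p∣⇒q⊆p (drop-∷-⊆ p⊆q) ∣q∣≤∣p∣)
p⊆q∧∣q∣≤∣p∣⇒q⊆p {p = outside ∷ p} {inside ∷ q} p⊆q ∣q∣≤∣p∣ =
  ⊥-elim (<⇒≱ (s≤s (p⊆q⇒∣p∣≤∣q∣ (drop-∷-⊆ p⊆q))) ∣q∣≤∣p∣)

∣p∣≤∣p∩q∣⇒p⊆q : ∀ {n} (p q : Subset n) → ∣ p ∣ ≤ ∣ p ∩ q ∣ → p ⊆ q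
∣p∣≤∣p∩q∣⇒p⊆q p q ∣p∣≤∣p∩q∣ = ⊆-trans (p⊆q∧∣q∣≤∣p∣⇒q⊆p (p∩q⊆p p q) ∣p∣≤∣p∩q∣) (p∩q⊆q p q)

∣p∣∸∣p∩q∣≤0⇒p≡q : ∀ {n} (p q : Subset n) → ∣ p ∣ ≡ ∣ q ∣ → ∣ p ∣ ∸ ∣ p ∩ q ∣ ≤ 0 → p ≡ q
∣p∣∸∣p∩q∣≤0⇒p≡q p q ∣p∣≡∣q∣ ∣p∣∸∣p∩q∣≤0 =
  ⊆-antisym p⊆q (p⊆q∧∣q∣≤∣p∣⇒q⊆p p⊆q (≤-reflexive (sym ∣p∣≡∣q∣)))
  where p⊆q = ∣p∣≤∣p∩q∣⇒p⊆q p q (m∸n≡0⇒m≤n (n≤0⇒n≡0 ∣p∣∸∣p∩q∣≤0))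

∣p∪q∣+∣p∩q∣≡∣p∣+∣q∣ : ∀ {n} (p q : Subset n) → ∣ p ∪ q ∣ + ∣ p ∩ q ∣ ≡ ∣ p ∣ + ∣ q ∣
∣p∪q∣+∣p∩q∣≡∣p∣+∣q∣ [] [] = refl
∣p∪q∣+∣p∩q∣≡∣p∣+∣q∣ (inside ∷ p) (inside ∷ q) = cong suc (begin
  ∣ p ∪ q ∣ + suc ∣ p ∩ q ∣ ≡⟨ +-suc _ _ ⟩
  suc (∣ p ∪ q ∣ + ∣ p ∩ q ∣) ≡⟨ cong suc (∣p∪q∣+∣p∩q∣≡∣p∣+∣q∣ p q) ⟩
  suc (∣ p ∣ + ∣ q ∣) ≡⟨ +-suc _ _ ⟨
  ∣ p ∣ + suc ∣ q ∣ ∎)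
  where open ≡-Reasoning
∣p∪q∣+∣p∩q∣≡∣p∣+∣q∣ (inside ∷ p) (outside ∷ q) = cong suc (∣p∪q∣+∣p∩q∣≡∣p∣+∣q∣ p q)
∣p∪q∣+∣p∩q∣≡∣p∣+∣q∣ (outside ∷ p) (inside ∷ q) =
  trans (cong suc (∣p∪q∣+∣p∩q∣≡∣p∣+∣q∣ p q)) (sym (+-suc _ _))
∣p∪q∣+∣p∩q∣≡∣p∣+∣q∣ (outside ∷ p) (outside ∷ q) = ∣p∪q∣+∣p∩q∣≡∣p∣+∣q∣ p q

p∩q⊆r⊆p⇒r∩q≡p∩q : ∀ {n} {p q r : Subset n} → p ∩ q ⊆ r → r ⊆ p → r ∩ q ≡ p ∩ q
p∩q⊆r⊆p⇒r∩q≡p∩q {p = p} {q} {r} p∩q⊆r r⊆p = ⊆-antisym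
  (λ x∈r∩q → let x∈r , x∈q = x∈p∩q⁻ r q x∈r∩q in x∈p∩q⁺ (r⊆p x∈r , x∈q))
  (λ x∈p∩q → x∈p∩q⁺ (p∩q⊆r x∈p∩q , proj₂ (x∈p∩q⁻ p q x∈p∩q)))

p⊆r⊆p∪q⇒∣r∣+∣p∩q∣≡∣p∣+∣r∩q∣ : ∀ {n} {p q r : Subset n} → p ⊆ r → r ⊆ p ∪ q →
  ∣ r ∣ + ∣ p ∩ q ∣ ≡ ∣ p ∣ + ∣ r ∩ q ∣
p⊆r⊆p∪q⇒∣r∣+∣p∩q∣≡∣p∣+∣r∩q∣ {p = p} {q} {r} p⊆r r⊆p∪q = begin
  ∣ r ∣ + ∣ p ∩ q ∣                 ≡⟨ cong₂ (λ s t → ∣ s ∣ + ∣ t ∣) r≡p∪[r∩q] p∩q≡p∩[r∩q] ⟩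
  ∣ p ∪ (r ∩ q) ∣ + ∣ p ∩ (r ∩ q) ∣ ≡⟨ ∣p∪q∣+∣p∩q∣≡∣p∣+∣q∣ p (r ∩ q) ⟩
  ∣ p ∣ + ∣ r ∩ q ∣                 ∎
  where
  open ≡-Reasoning
  r≡p∪[r∩q] : r ≡ p ∪ (r ∩ q)
  r≡p∪[r∩q] = ⊆-antisym
    (λ x∈r → [ (λ x∈p → x∈p∪q⁺ (inj₁ x∈p)) , (λ x∈q → x∈p∪q⁺ (inj₂ (x∈p∩q⁺ (x∈r , x∈q)))) ]
               (x∈p∪q⁻ p q (r⊆p∪q x∈r)))
    (λ x∈p∪[r∩q] → [ p⊆r , (λ x∈r∩q → proj₁ (x∈p∩q⁻ r q x∈r∩q)) ] (x∈p∪q⁻ p (r ∩ q) x∈p∪[r∩q]))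
  p∩q≡p∩[r∩q] : p ∩ q ≡ p ∩ (r ∩ q)
  p∩q≡p∩[r∩q] = ⊆-antisym
    (λ x∈p∩q → let x∈p , x∈q = x∈p∩q⁻ p q x∈p∩q in x∈p∩q⁺ (x∈p , x∈p∩q⁺ (p⊆r x∈p , x∈q)))
    (λ x∈p∩[r∩q] → let x∈p , x∈r∩q = x∈p∩q⁻ p (r ∩ q) x∈p∩[r∩q]
                    in x∈p∩q⁺ (x∈p , proj₂ (x∈p∩q⁻ r q x∈r∩q)))

a≤⌈a/m⌉*m : ∀ a m → 0 < m → a ≤ ⌈ a / m ⌉ * m
a≤⌈a/m⌉*m a (suc m) _ = +-cancelʳ-≤ m a _ (begin
  a + m                       ≡⟨ m≡m%n+[m/n]*n (a + m) (suc m) ⟩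
  (a + m) % suc m + q * suc m ≤⟨ +-monoˡ-≤ (q * suc m) (≤-pred (m%n<n (a + m) (suc m))) ⟩
  m + q * suc m               ≡⟨ +-comm m _ ⟩
  q * suc m + m               ∎)
  where open ≤-Reasoning
        q = (a + m) / suc m

[m+n]∸o≤n+p⇒m∸o≤p : ∀ m n o p → (m + n) ∸ o ≤ n + p → m ∸ o ≤ p
[m+n]∸o≤n+p⇒m∸o≤p m n o p h = begin
  m ∸ o             ≡⟨ [m+n]∸[m+o]≡n∸o n m o ⟨
  (n + m) ∸ (n + o) ≡⟨ cong₂ _∸_ (+-comm n m) (+-comm n o) ⟩
  (m + n) ∸ (o + n) ≡⟨ ∸-+-assoc (m + n) o n ⟨
  (m + n) ∸ o ∸ n   ≤⟨ m≤n+o⇒m∸n≤o _ n h ⟩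
  p                 ∎
  where open ≤-Reasoning

n∸k∸k≡n∸2k : ∀ n k → n ∸ k ∸ k ≡ n ∸ 2 * k
n∸k∸k≡n∸2k n k = trans (∸-+-assoc n k k) (cong (λ j → n ∸ (k + j)) (sym (+-identityʳ k)))

module Distance (n k m : ℕ) (n∸k≡k+m : n ∸ k ≡ k + m) where

  k≤n∸k : k ≤ n ∸ k
  k≤n∸k = subst (k ≤_) (sym n∸k≡k+m) (m≤m+n k m)

  n∸k≤∣⊤∣ : n ∸ k ≤ ∣ ⊤ {n} ∣
  n∸k≤∣⊤∣ = subst (n ∸ k ≤_) (sym (∣⊤∣≡n n)) (m∸n≤m n k)

  Closer : Subset n → Subset n → Set
  Closer A A′ =
    Σ[ C ∈ Subset n ] (∣ C ∣ ≡ k × Dist≤ n k A C 2 × k ∸ ∣ C ∩ A′ ∣ ≤ k ∸ ∣ A ∩ A′ ∣ ∸ m)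

  closer-via-superset : ∀ {A A′ B} → ∣ A ∣ ≡ k → ∣ A′ ∣ ≡ k → ∣ B ∣ ≡ n ∸ k →
    A ⊆ B → A′ ⊆ B → Closer A A′
  closer-via-superset {A′ = A′} ∣A∣≡k ∣A′∣≡k ∣B∣≡n∸k A⊆B A′⊆B =
    A′ , ∣A′∣≡k ,
    commonNeighbour⇒Dist≤2 (inj₁ (∣A∣≡k , ∣B∣≡n∸k , A⊆B)) (inj₁ (∣A′∣≡k , ∣B∣≡n∸k , A′⊆B)) ,
    ≤-trans (≤-reflexive no-deficit) z≤n
    where
    no-deficit : k ∸ ∣ A′ ∩ A′ ∣ ≡ 0
    no-deficit = trans (cong (λ s → k ∸ ∣ s ∣) (∩-idem A′)) (trans (cong (k ∸_) ∣A′∣≡k) (n∸n≡0 k))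

  closer : ∀ {A A′} → ∣ A ∣ ≡ k → ∣ A′ ∣ ≡ k → Closer A A′
  closer {A} {A′} ∣A∣≡k ∣A′∣≡k with n ∸ k ≤? ∣ A ∪ A′ ∣
  ... | no ∣A∪A′∣<n∸k with ∃-⊆-between (n ∸ k) ⊆⊤ (<⇒≤ (≰⇒> ∣A∪A′∣<n∸k)) n∸k≤∣⊤∣
  ...   | B , A∪A′⊆B , _ , ∣B∣≡n∸k =
    closer-via-superset ∣A∣≡k ∣A′∣≡k ∣B∣≡n∸k
      (λ x∈A → A∪A′⊆B (p⊆p∪q A′ x∈A)) (λ x∈A′ → A∪A′⊆B (q⊆p∪q A A′ x∈A′))
  closer {A} {A′} ∣A∣≡k ∣A′∣≡k | yes n∸k≤∣A∪A′∣
    with ∃-⊆-between (n ∸ k) (p⊆p∪q A′) (subst (_≤ n ∸ k) (sym ∣A∣≡k) k≤n∸k) n∸k≤∣A∪A′∣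
  ... | B , A⊆B , B⊆A∪A′ , ∣B∣≡n∸k with k ≤? ∣ B ∩ A′ ∣
  ...   | yes k≤∣B∩A′∣ =
    closer-via-superset ∣A∣≡k ∣A′∣≡k ∣B∣≡n∸k A⊆B
      (⊆-trans (p⊆q∧∣q∣≤∣p∣⇒q⊆p (p∩q⊆q B A′) (subst (_≤ _) (sym ∣A′∣≡k) k≤∣B∩A′∣)) (p∩q⊆p B A′))
  ...   | no ∣B∩A′∣<k
    with ∃-⊆-between k (p∩q⊆p B A′) (<⇒≤ (≰⇒> ∣B∩A′∣<k)) (subst (k ≤_) (sym ∣B∣≡n∸k) k≤n∸k)
  ...     | C , B∩A′⊆C , C⊆B , ∣C∣≡k =
    C , ∣C∣≡k ,
    commonNeighbour⇒Dist≤2 (inj₁ (∣A∣≡k , ∣B∣≡n∸k , A⊆B)) (inj₁ (∣C∣≡k , ∣B∣≡n∸k , C⊆B)) ,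
    ≤-reflexive deficit
    where
    ∣B∩A′∣≡m+∣A∩A′∣ : ∣ B ∩ A′ ∣ ≡ m + ∣ A ∩ A′ ∣
    ∣B∩A′∣≡m+∣A∩A′∣ = sym (+-cancelˡ-≡ k _ _ (begin
      k + (m + ∣ A ∩ A′ ∣) ≡⟨ +-assoc k m _ ⟨
      k + m + ∣ A ∩ A′ ∣   ≡⟨ cong₂ _+_ (trans (sym n∸k≡k+m) (sym ∣B∣≡n∸k)) refl ⟩
      ∣ B ∣ + ∣ A ∩ A′ ∣   ≡⟨ p⊆r⊆p∪q⇒∣r∣+∣p∩q∣≡∣p∣+∣r∩q∣ A⊆B B⊆A∪A′ ⟩
      ∣ A ∣ + ∣ B ∩ A′ ∣   ≡⟨ cong₂ _+_ ∣A∣≡k refl ⟩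
      k + ∣ B ∩ A′ ∣       ∎))
      where open ≡-Reasoning
    deficit : k ∸ ∣ C ∩ A′ ∣ ≡ k ∸ ∣ A ∩ A′ ∣ ∸ m
    deficit = begin
      k ∸ ∣ C ∩ A′ ∣        ≡⟨ cong (λ s → k ∸ ∣ s ∣) (p∩q⊆r⊆p⇒r∩q≡p∩q B∩A′⊆C C⊆B) ⟩
      k ∸ ∣ B ∩ A′ ∣        ≡⟨ cong (k ∸_) (trans ∣B∩A′∣≡m+∣A∩A′∣ (+-comm m _)) ⟩
      k ∸ (∣ A ∩ A′ ∣ + m)  ≡⟨ ∸-+-assoc k ∣ A ∩ A′ ∣ m ⟨
      k ∸ ∣ A ∩ A′ ∣ ∸ m    ∎
      where open ≡-Reasoning

  small-dist : ∀ d {A A′} → ∣ A ∣ ≡ k → ∣ A′ ∣ ≡ k → k ∸ ∣ A ∩ A′ ∣ ≤ d * m →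
    Dist≤ n k A A′ (2 * d)
  small-dist zero {A} {A′} ∣A∣≡k ∣A′∣≡k deficit≤0 =
    Dist≤-≡ (∣p∣∸∣p∩q∣≤0⇒p≡q A A′ (trans ∣A∣≡k (sym ∣A′∣≡k))
      (subst (λ a → a ∸ ∣ A ∩ A′ ∣ ≤ 0) (sym ∣A∣≡k) deficit≤0))
  small-dist (suc d) ∣A∣≡k ∣A′∣≡k deficit≤ with closer ∣A∣≡k ∣A′∣≡k
  ... | C , ∣C∣≡k , A~C , deficit-shrinks =
    Dist≤-weaken (≤-reflexive (sym (*-suc 2 d)))
      (Dist≤-trans A~C
        (small-dist d ∣C∣≡k ∣A′∣≡k (≤-trans deficit-shrinks (m≤n+o⇒m∸n≤o _ m deficit≤))))

  large-dist : ∀ d {A A′} → ∣ A ∣ ≡ n ∸ k → ∣ A′ ∣ ≡ n ∸ k → (n ∸ k) ∸ ∣ A ∩ A′ ∣ ≤ d * m →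
    Dist≤ n k A A′ (2 * d)
  large-dist zero {A} {A′} ∣A∣≡n∸k ∣A′∣≡n∸k deficit≤0 =
    Dist≤-≡ (∣p∣∸∣p∩q∣≤0⇒p≡q A A′ (trans ∣A∣≡n∸k (sym ∣A′∣≡n∸k))
      (subst (λ a → a ∸ ∣ A ∩ A′ ∣ ≤ 0) (sym ∣A∣≡n∸k) deficit≤0))
  large-dist (suc d) {A} {A′} ∣A∣≡n∸k ∣A′∣≡n∸k deficit≤ with k ≤? ∣ A ∩ A′ ∣
  ... | yes k≤∣A∩A′∣
    with ∃-⊆-between k (⊥⊆ {p = A ∩ A′}) (subst (_≤ k) (sym (∣⊥∣≡0 n)) z≤n) k≤∣A∩A′∣
  ...   | C , _ , C⊆A∩A′ , ∣C∣≡k =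
    Dist≤-weaken (*-monoʳ-≤ 2 (s≤s (z≤n {d})))
      (commonNeighbour⇒Dist≤2 (inj₂ (∣C∣≡k , ∣A∣≡n∸k , ⊆-trans C⊆A∩A′ (p∩q⊆p A A′)))
                              (inj₂ (∣C∣≡k , ∣A′∣≡n∸k , ⊆-trans C⊆A∩A′ (p∩q⊆q A A′))))
  large-dist (suc d) {A} {A′} ∣A∣≡n∸k ∣A′∣≡n∸k deficit≤ | no k≰∣A∩A′∣
    with ∃-⊆-between k (p∩q⊆p A A′) (<⇒≤ (≰⇒> k≰∣A∩A′∣)) (subst (k ≤_) (sym ∣A∣≡n∸k) k≤n∸k)
       | ∃-⊆-between k (p∩q⊆q A A′) (<⇒≤ (≰⇒> k≰∣A∩A′∣)) (subst (k ≤_) (sym ∣A′∣≡n∸k) k≤n∸k)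
  ... | C , A∩A′⊆C , C⊆A , ∣C∣≡k | C′ , A∩A′⊆C′ , C′⊆A′ , ∣C′∣≡k =
    Dist≤-weaken (≤-reflexive (trans (cong suc (+-comm (2 * d) 1)) (sym (*-suc 2 d))))
      (Dist≤-trans (Edge⇒Dist≤1 (inj₂ (∣C∣≡k , ∣A∣≡n∸k , C⊆A)))
        (Dist≤-trans (small-dist d ∣C∣≡k ∣C′∣≡k deficit≤′)
                     (Edge⇒Dist≤1 (inj₁ (∣C′∣≡k , ∣A′∣≡n∸k , C′⊆A′)))))
    where
    C∩C′≡A∩A′ : C ∩ C′ ≡ A ∩ A′
    C∩C′≡A∩A′ = ⊆-antisym
      (λ x∈C∩C′ → let x∈C , x∈C′ = x∈p∩q⁻ C C′ x∈C∩C′ in x∈p∩q⁺ (C⊆A x∈C , C′⊆A′ x∈C′))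
      (λ x∈A∩A′ → x∈p∩q⁺ (A∩A′⊆C x∈A∩A′ , A∩A′⊆C′ x∈A∩A′))
    deficit≤′ : k ∸ ∣ C ∩ C′ ∣ ≤ d * m
    deficit≤′ = subst (λ s → k ∸ ∣ s ∣ ≤ d * m) (sym C∩C′≡A∩A′)
      ([m+n]∸o≤n+p⇒m∸o≤p k m ∣ A ∩ A′ ∣ (d * m)
        (subst (λ a → a ∸ ∣ A ∩ A′ ∣ ≤ m + d * m) n∸k≡k+m deficit≤))

  mixed-dist : ∀ d {A B} → ∣ A ∣ ≡ n ∸ k → ∣ B ∣ ≡ k → k ∸ ∣ A ∩ B ∣ ≤ d * m →
    Dist≤ n k A B (2 * d + 1)
  mixed-dist d {A} {B} ∣A∣≡n∸k ∣B∣≡k deficit≤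
    with ∃-⊆-between k (p∩q⊆p A B) (subst (∣ A ∩ B ∣ ≤_) ∣B∣≡k (∣p∩q∣≤∣q∣ A B))
                       (subst (k ≤_) (sym ∣A∣≡n∸k) k≤n∸k)
  ... | C , A∩B⊆C , C⊆A , ∣C∣≡k =
    Dist≤-weaken (≤-reflexive (+-comm 1 (2 * d)))
      (Dist≤-trans (Edge⇒Dist≤1 (inj₂ (∣C∣≡k , ∣A∣≡n∸k , C⊆A)))
                   (small-dist d ∣C∣≡k ∣B∣≡k
                     (subst (λ s → k ∸ ∣ s ∣ ≤ d * m) (sym (p∩q⊆r⊆p⇒r∩q≡p∩q A∩B⊆C C⊆A)) deficit≤)))

  equal-size-dist : ∀ d {A B} → IsVertex n k A → ∣ A ∣ ≡ ∣ B ∣ → ∣ A ∣ ∸ ∣ A ∩ B ∣ ≤ d * m →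
    Dist≤ n k A B (2 * d)
  equal-size-dist d {A} {B} (inj₁ ∣A∣≡k) ∣A∣≡∣B∣ deficit≤ =
    small-dist d ∣A∣≡k (trans (sym ∣A∣≡∣B∣) ∣A∣≡k)
      (subst (λ a → a ∸ ∣ A ∩ B ∣ ≤ d * m) ∣A∣≡k deficit≤)
  equal-size-dist d {A} {B} (inj₂ ∣A∣≡n∸k) ∣A∣≡∣B∣ deficit≤ =
    large-dist d ∣A∣≡n∸k (trans (sym ∣A∣≡∣B∣) ∣A∣≡n∸k)
      (subst (λ a → a ∸ ∣ A ∩ B ∣ ≤ d * m) ∣A∣≡n∸k deficit≤)

  distinct-size-dist : ∀ d {A B} → IsVertex n k A → IsVertex n k B → ∣ A ∣ ≢ ∣ B ∣ →
    k ∸ ∣ A ∩ B ∣ ≤ d * m → Dist≤ n k A B (2 * d + 1)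
  distinct-size-dist d (inj₁ ∣A∣≡k) (inj₁ ∣B∣≡k) ∣A∣≢∣B∣ _ =
    ⊥-elim (∣A∣≢∣B∣ (trans ∣A∣≡k (sym ∣B∣≡k)))
  distinct-size-dist d (inj₂ ∣A∣≡n∸k) (inj₂ ∣B∣≡n∸k) ∣A∣≢∣B∣ _ =
    ⊥-elim (∣A∣≢∣B∣ (trans ∣A∣≡n∸k (sym ∣B∣≡n∸k)))
  distinct-size-dist d {A} {B} (inj₁ ∣A∣≡k) (inj₂ ∣B∣≡n∸k) _ deficit≤ =
    Dist≤-sym (mixed-dist d ∣B∣≡n∸k ∣A∣≡k (subst (λ s → k ∸ ∣ s ∣ ≤ d * m) (∩-comm A B) deficit≤))
  distinct-size-dist d (inj₂ ∣A∣≡n∸k) (inj₁ ∣B∣≡k) _ deficit≤ = mixed-dist d ∣A∣≡n∸k ∣B∣≡k deficit≤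

mainTheorem2 : (n k : ℕ) → k < n ∸ k → (A B : Subset n) →
    IsVertex n k A → IsVertex n k B → (i : ℕ) → ∣ A ∩ B ∣ ≡ i →
    (∣ A ∣ ≢ ∣ B ∣ → Dist≤ n k A B (2 * ⌈ (k ∸ i) / (n ∸ 2 * k) ⌉ + 1)) ×
    (∣ A ∣ ≡ ∣ B ∣ → Dist≤ n k A B (2 * ⌈ (∣ A ∣ ∸ i) / (n ∸ 2 * k) ⌉))
mainTheorem2 n k k<n∸k A B A∈V B∈V i refl =
  (λ ∣A∣≢∣B∣ → distinct-size-dist ⌈ (k ∸ i) / m ⌉ A∈V B∈V ∣A∣≢∣B∣ (a≤⌈a/m⌉*m _ m 0<m)) ,
  (λ ∣A∣≡∣B∣ → equal-size-dist ⌈ (∣ A ∣ ∸ i) / m ⌉ A∈V ∣A∣≡∣B∣ (a≤⌈a/m⌉*m _ m 0<m))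
  where
  m = n ∸ 2 * k
  n∸k≡k+m : n ∸ k ≡ k + m
  n∸k≡k+m = trans (sym (m+[n∸m]≡n (<⇒≤ k<n∸k))) (cong (k +_) (n∸k∸k≡n∸2k n k))
  0<m : 0 < m
  0<m = subst (0 <_) (n∸k∸k≡n∸2k n k) (m<n⇒0<n∸m k<n∸k)
  open Distance n k m n∸k≡k+m
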